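{- For every pair of positive integers $k$ and $\ell$, we have $\chi'_{st}(C_{3k} \,\square\, C_{3\ell}) = 6$.
   Context: A star edge-coloring of a graph $G$ is a proper edge-coloring of $G$ in which there is no bichromatic path and no bichromatic cycle of length four (i.e., with four edges). The star chromatic index $\chi'_{st}(G)$ is the minimum number of colors in a star edge-coloring of $G$. $C_m$ denotes the cycle on $m$ vertices. $G \,\square\, H$ denotes the Cartesian product: vertex set $V(G)\times V(H)$, with $(u,v)(u',v')$ an edge iff either $uu'\in E(G)$ and $v=v'$, or $u=u'$ and $vv'\in E(H)$. -}

module Defs where

open import Data.Nat using (ℕ; zero; suc; _≤_)
open import Data.Fin using (Fin; toℕ)
open import Data.Product using (Σ; _×_; _,_)
open import Data.Sum using (_⊎_)
open import Relation.Nullary using (¬_)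
open import Relation.Binary.PropositionalEquality using (_≡_)

-- A simple graph: vertex type and adjacency relation (assumed symmetric, irreflexive
-- for the graphs constructed below).
record Graph : Set₁ where
  field
    V   : Set
    Adj : V → V → Set
open Graph public

CycSucc : (m : ℕ) → Fin m → Fin m → Set
CycSucc m i j = (suc (toℕ i) ≡ toℕ j) ⊎ ((suc (toℕ i) ≡ m) × (toℕ j ≡ 0))

Cycle : ℕ → Graph
Cycle m = record { V = Fin m ; Adj = λ i j → CycSucc m i j ⊎ CycSucc m j i }

_□_ : Graph → Graph → Graph
G □ H = record
  { V   = V G × V H
  ; Adj = λ { (u , v) (u' , v') →
              (Adj G u u' × (v ≡ v')) ⊎ ((u ≡ u') × Adj H v v') } }

-- An edge colouring with k colours is a function on ordered pairs of vertices;
-- only its values on edges matter, and it must be symmetric there.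
EdgeColouring : Graph → ℕ → Set
EdgeColouring G k = V G → V G → Fin k

module _ (G : Graph) {k : ℕ} (c : EdgeColouring G k) where

  Symmetric : Set
  Symmetric = ∀ u v → Adj G u v → c u v ≡ c v u

  Proper : Set
  Proper = ∀ u v w → Adj G u v → Adj G u w → ¬ (v ≡ w) → ¬ (c u v ≡ c u w)

  In₂ : Fin k → Fin k → Fin k → Set
  In₂ a b x = (x ≡ a) ⊎ (x ≡ b)

  BichromaticPath4 : Set
  BichromaticPath4 =
    Σ (V G) λ v0 → Σ (V G) λ v1 → Σ (V G) λ v2 → Σ (V G) λ v3 → Σ (V G) λ v4 →
    Σ (Fin k) λ a → Σ (Fin k) λ b →
      Adj G v0 v1 × Adj G v1 v2 × Adj G v2 v3 × Adj G v3 v4 ×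
      ¬ (v0 ≡ v1) × ¬ (v0 ≡ v2) × ¬ (v0 ≡ v3) × ¬ (v0 ≡ v4) ×
      ¬ (v1 ≡ v2) × ¬ (v1 ≡ v3) × ¬ (v1 ≡ v4) ×
      ¬ (v2 ≡ v3) × ¬ (v2 ≡ v4) × ¬ (v3 ≡ v4) ×
      In₂ a b (c v0 v1) × In₂ a b (c v1 v2) × In₂ a b (c v2 v3) × In₂ a b (c v3 v4)

  BichromaticCycle4 : Set
  BichromaticCycle4 =
    Σ (V G) λ v0 → Σ (V G) λ v1 → Σ (V G) λ v2 → Σ (V G) λ v3 →
    Σ (Fin k) λ a → Σ (Fin k) λ b →
      Adj G v0 v1 × Adj G v1 v2 × Adj G v2 v3 × Adj G v3 v0 ×
      ¬ (v0 ≡ v1) × ¬ (v0 ≡ v2) × ¬ (v0 ≡ v3) ×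
      ¬ (v1 ≡ v2) × ¬ (v1 ≡ v3) × ¬ (v2 ≡ v3) ×
      In₂ a b (c v0 v1) × In₂ a b (c v1 v2) × In₂ a b (c v2 v3) × In₂ a b (c v3 v0)

  IsStarEdgeColouring : Set
  IsStarEdgeColouring =
    Symmetric × Proper × ¬ BichromaticPath4 × ¬ BichromaticCycle4

StarColourable : Graph → ℕ → Set
StarColourable G k = Σ (EdgeColouring G k) λ c → IsStarEdgeColouring G c

StarChromaticIndexIs : Graph → ℕ → Set
StarChromaticIndexIs G n = StarColourable G n × (∀ k → StarColourable G k → n ≤ k)

-- Upper bound: as 3 divides both cycle lengths, reducing both coordinates mod 3 is a
-- covering of the 3 × 3 torus. A 6-colouring of the torus with no non-backtracking
-- walk of four edges coloured a b a b lifts along it, and in the lift every bichromatic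
-- path or 4-cycle would be such a walk.
--
-- Lower bound: let v be a vertex of a 4-regular graph with a star edge-colouring. For
-- two edges vx, vy either x misses the colour of vy or y misses the colour of vx, for
-- otherwise there is a bichromatic path or 4-cycle through x, v, y. This orients the six
-- pairs of neighbours of v into a tournament on four vertices, so some neighbour misses
-- two colours besides seeing its own four: at least six colours are used.
module Submission where

open import Defs
open import Data.Nat using (ℕ; zero; suc; _+_; _*_; _≤_; _<?_; s≤s; z≤n)
open import Data.Nat.Properties using (*-comm; ≤-antisym; ≮⇒≥; <-irrefl; suc-injective)
open import Data.Fin using (Fin; zero; suc; toℕ; _<_; fromℕ; fromℕ<; inject₁; _↑ˡ_; _↑ʳ_)
open import Data.Fin.Properties
  using (_≟_; all?; any?; <⇒≢; pigeonhole; injective⇒≤;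
         toℕ-injective; toℕ<n; toℕ-fromℕ<; toℕ-fromℕ; toℕ-inject₁)
open import Data.Vec.Functional using (_∷_)
open import Data.Product using (Σ; ∃; ∃₂; _×_; _,_; proj₁; proj₂)
open import Data.Product.Properties using (≡-dec)
open import Data.Sum using (_⊎_; inj₁; inj₂)
open import Data.Empty using (⊥; ⊥-elim)
open import Function using (_∘_)
open import Function.Definitions using (Injective)
open import Relation.Nullary using (¬_; Dec; yes; no)
open import Relation.Nullary.Decidable
  using (from-yes; map′; ¬?; _→-dec_; _⊎-dec_; _×-dec_; decidable-stable)
open import Relation.Binary.PropositionalEquality
open ≡-Reasoning

fresh-∷-injective : ∀ {a} {A : Set a} {n} {f : Fin n → A} {x : A} →
                    Injective _≡_ _≡_ f → (∀ i → f i ≢ x) → Injective _≡_ _≡_ (x ∷ f)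
fresh-∷-injective f-inj fresh {zero}  {zero}  _ = refl
fresh-∷-injective f-inj fresh {zero}  {suc j} e = ⊥-elim (fresh j (sym e))
fresh-∷-injective f-inj fresh {suc i} {zero}  e = ⊥-elim (fresh i e)
fresh-∷-injective f-inj fresh {suc i} {suc j} e = cong suc (f-inj e)

two-colours-alternate : ∀ {a} {A : Set a} {p q x y z : A} →
                        (x ≡ p ⊎ x ≡ q) → (y ≡ p ⊎ y ≡ q) → (z ≡ p ⊎ z ≡ q) →
                        x ≢ y → y ≢ z → x ≡ z
two-colours-alternate (inj₁ refl) (inj₁ refl) _           x≢y _   = ⊥-elim (x≢y refl)
two-colours-alternate (inj₂ refl) (inj₂ refl) _           x≢y _   = ⊥-elim (x≢y refl)
two-colours-alternate (inj₁ refl) (inj₂ refl) (inj₁ refl) _   _   = refl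
two-colours-alternate (inj₂ refl) (inj₁ refl) (inj₂ refl) _   _   = refl
two-colours-alternate (inj₁ refl) (inj₂ refl) (inj₂ refl) _   y≢z = ⊥-elim (y≢z refl)
two-colours-alternate (inj₂ refl) (inj₁ refl) (inj₁ refl) _   y≢z = ⊥-elim (y≢z refl)

-- Non-backtracking walks x₀ … x₄ coloured a b a b. In a proper colouring these are
-- exactly the bichromatic 4-paths and 4-cycles, without the distinctness bookkeeping.
NoAlternatingWalk : {G : Graph} {k : ℕ} → EdgeColouring G k → Set
NoAlternatingWalk {G} c = ∀ {x₀ x₁ x₂ x₃ x₄} →
  Adj G x₀ x₁ → Adj G x₁ x₂ → Adj G x₂ x₃ → Adj G x₃ x₄ →
  x₀ ≢ x₂ → x₁ ≢ x₃ → x₂ ≢ x₄ →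
  c x₀ x₁ ≡ c x₂ x₃ → c x₁ x₂ ≡ c x₃ x₄ → ⊥

module _ {G : Graph} (adj-sym : ∀ {u w} → Adj G u w → Adj G w u)
         {k : ℕ} {c : EdgeColouring G k} where

  consecutive-colours-differ : Symmetric G c → Proper G c →
                               ∀ {u w x} → Adj G u w → Adj G w x → u ≢ x → c u w ≢ c w x
  consecutive-colours-differ c-sym proper uw wx u≢x e =
    proper _ _ _ (adj-sym uw) wx u≢x (trans (sym (c-sym _ _ uw)) e)

  noAlternatingWalk⇒star : Symmetric G c → Proper G c → NoAlternatingWalk c →
                           IsStarEdgeColouring G c
  noAlternatingWalk⇒star c-sym proper no-walk = c-sym , proper , no-path , no-cycle
    where
    differ : ∀ {u w x} → Adj G u w → Adj G w x → u ≢ x → c u w ≢ c w x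
    differ = consecutive-colours-differ c-sym proper

    no-path : ¬ BichromaticPath4 G c
    no-path (_ , _ , _ , _ , _ , _ , _ , a₀₁ , a₁₂ , a₂₃ , a₃₄ ,
             _ , v₀≢v₂ , _ , _ , _ , v₁≢v₃ , _ , _ , v₂≢v₄ , _ , i₀₁ , i₁₂ , i₂₃ , i₃₄) =
      no-walk a₀₁ a₁₂ a₂₃ a₃₄ v₀≢v₂ v₁≢v₃ v₂≢v₄
        (two-colours-alternate i₀₁ i₁₂ i₂₃ (differ a₀₁ a₁₂ v₀≢v₂) (differ a₁₂ a₂₃ v₁≢v₃))
        (two-colours-alternate i₁₂ i₂₃ i₃₄ (differ a₁₂ a₂₃ v₁≢v₃) (differ a₂₃ a₃₄ v₂≢v₄))

    no-cycle : ¬ BichromaticCycle4 G c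
    no-cycle (v₀ , _ , v₂ , _ , _ , _ , a₀₁ , a₁₂ , a₂₃ , a₃₀ ,
              _ , v₀≢v₂ , _ , _ , v₁≢v₃ , _ , i₀₁ , i₁₂ , i₂₃ , i₃₀) =
      no-walk a₀₁ a₁₂ a₂₃ a₃₀ v₀≢v₂ v₁≢v₃ v₂≢v₀
        (two-colours-alternate i₀₁ i₁₂ i₂₃ (differ a₀₁ a₁₂ v₀≢v₂) (differ a₁₂ a₂₃ v₁≢v₃))
        (two-colours-alternate i₁₂ i₂₃ i₃₀ (differ a₁₂ a₂₃ v₁≢v₃) (differ a₂₃ a₃₀ v₂≢v₀))
      where
      v₂≢v₀ : v₂ ≢ v₀
      v₂≢v₀ = v₀≢v₂ ∘ sym

  star⇒noAlternatingWalk : (∀ u → ¬ Adj G u u) → IsStarEdgeColouring G c →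
                           NoAlternatingWalk c
  star⇒noAlternatingWalk adj-irrefl (c-sym , proper , no-path , no-cycle)
    {x₀} {x₁} {x₂} {x₃} {x₄} a₀₁ a₁₂ a₂₃ a₃₄ x₀≢x₂ x₁≢x₃ x₂≢x₄ c₀₁≡c₂₃ c₁₂≡c₃₄ =
    no-path (x₀ , x₁ , x₂ , x₃ , x₄ , c x₀ x₁ , c x₁ x₂ , a₀₁ , a₁₂ , a₂₃ , a₃₄ ,
             x₀≢x₁ , x₀≢x₂ , x₀≢x₃ , x₀≢x₄ , x₁≢x₂ , x₁≢x₃ , x₁≢x₄ ,
             x₂≢x₃ , x₂≢x₄ , x₃≢x₄ ,
             inj₁ refl , inj₂ refl , inj₁ (sym c₀₁≡c₂₃) , inj₂ (sym c₁₂≡c₃₄))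
    where
    adj⇒≢ : ∀ {u w} → Adj G u w → u ≢ w
    adj⇒≢ uw refl = adj-irrefl _ uw

    x₀≢x₁ : x₀ ≢ x₁
    x₀≢x₁ = adj⇒≢ a₀₁
    x₁≢x₂ : x₁ ≢ x₂
    x₁≢x₂ = adj⇒≢ a₁₂
    x₂≢x₃ : x₂ ≢ x₃
    x₂≢x₃ = adj⇒≢ a₂₃
    x₃≢x₄ : x₃ ≢ x₄
    x₃≢x₄ = adj⇒≢ a₃₄

    x₀≢x₃ : x₀ ≢ x₃
    x₀≢x₃ refl = proper x₀ x₁ x₂ a₀₁ (adj-sym a₂₃) x₁≢x₂
                   (trans c₀₁≡c₂₃ (c-sym x₂ x₀ a₂₃))

    x₁≢x₄ : x₁ ≢ x₄
    x₁≢x₄ refl = proper x₁ x₂ x₃ a₁₂ (adj-sym a₃₄) x₂≢x₃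
                   (trans c₁₂≡c₃₄ (c-sym x₃ x₁ a₃₄))

    -- The goal is ⊥, so the 4-cycle case can be refuted first instead of deciding x₀ ≟ x₄.
    x₀≢x₄ : x₀ ≢ x₄
    x₀≢x₄ refl = no-cycle (x₀ , x₁ , x₂ , x₃ , c x₀ x₁ , c x₁ x₂ , a₀₁ , a₁₂ , a₂₃ , a₃₄ ,
                           x₀≢x₁ , x₀≢x₂ , x₀≢x₃ , x₁≢x₂ , x₁≢x₃ , x₂≢x₃ ,
                           inj₁ refl , inj₂ refl , inj₁ (sym c₀₁≡c₂₃) , inj₂ (sym c₁₂≡c₃₄))

Dir : Set
Dir = Fin 4

pattern east  = zero
pattern west  = suc zero
pattern north = suc (suc zero)
pattern south = suc (suc (suc zero))

opp : Dir → Dir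
opp east  = west
opp west  = east
opp north = south
opp south = north

record Compass (G : Graph) : Set where
  field
    nbr             : Dir → V G → V G
    adj-nbr         : ∀ d u → Adj G u (nbr d u)
    adj⇒nbr         : ∀ {u w} → Adj G u w → ∃ λ d → w ≡ nbr d u
    nbr-opp         : ∀ d u → nbr (opp d) (nbr d u) ≡ u
    nbr-injective   : ∀ u {d d′} → nbr d u ≡ nbr d′ u → d ≡ d′
    nbr-irreflexive : ∀ d u → nbr d u ≢ u

  adj-sym : ∀ {u w} → Adj G u w → Adj G w u
  adj-sym {u} uw with adj⇒nbr uw
  ... | d , refl = subst (Adj G (nbr d u)) (nbr-opp d u) (adj-nbr (opp d) (nbr d u))

  adj-irreflexive : ∀ u → ¬ Adj G u u
  adj-irreflexive u uu with adj⇒nbr uu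
  ... | d , u≡nbr = nbr-irreflexive d u (sym u≡nbr)

-- The six unordered pairs of directions.
fst snd : Fin 6 → Dir
fst zero                                = east
fst (suc zero)                          = east
fst (suc (suc zero))                    = east
fst (suc (suc (suc zero)))              = west
fst (suc (suc (suc (suc zero))))        = west
fst (suc (suc (suc (suc (suc zero)))))  = north
snd zero                                = west
snd (suc zero)                          = north
snd (suc (suc zero))                    = south
snd (suc (suc (suc zero)))              = north
snd (suc (suc (suc (suc zero))))        = south
snd (suc (suc (suc (suc (suc zero)))))  = south

fst≢snd : ∀ π → fst π ≢ snd π
fst≢snd = from-yes (all? λ π → ¬? (fst π ≟ snd π))

Endpoints : Fin 6 → Dir → Dir → Set
Endpoints π d d′ = (d ≡ fst π × d′ ≡ snd π) ⊎ (d ≡ snd π × d′ ≡ fst π)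

endpoints-injective : ∀ π π′ d d′ → Endpoints π d d′ → Endpoints π′ d d′ → π ≡ π′
endpoints-injective = from-yes
  (all? λ π → all? λ π′ → all? λ d → all? λ d′ →
     endpoints? π d d′ →-dec endpoints? π′ d d′ →-dec π ≟ π′)
  where
  endpoints? : ∀ π d d′ → Dec (Endpoints π d d′)
  endpoints? π d d′ = (d ≟ fst π ×-dec d′ ≟ snd π) ⊎-dec (d ≟ snd π ×-dec d′ ≟ fst π)

tournament₄-outdegree≥2 : {_⇝_ : Dir → Dir → Set} →
                          (∀ {d d′} → d ≢ d′ → d ⇝ d′ ⊎ d′ ⇝ d) →
                          ∃ λ d → ∃₂ λ d′ d″ → d′ ≢ d″ × d ⇝ d′ × d ⇝ d″
tournament₄-outdegree≥2 {_⇝_} total =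
  fork (pigeonhole (s≤s (s≤s (s≤s (s≤s (s≤s z≤n))))) tail)
  where
  Arc : Fin 6 → Set
  Arc π = Σ (Dir × Dir) λ (d , d′) → d ⇝ d′ × Endpoints π d d′

  orient : ∀ π → Arc π
  orient π with total (fst≢snd π)
  ... | inj₁ fst⇝snd = (fst π , snd π) , fst⇝snd , inj₁ (refl , refl)
  ... | inj₂ snd⇝fst = (snd π , fst π) , snd⇝fst , inj₂ (refl , refl)

  tail head : Fin 6 → Dir
  tail π = proj₁ (proj₁ (orient π))
  head π = proj₂ (proj₁ (orient π))

  arc : ∀ π → tail π ⇝ head π
  arc π = proj₁ (proj₂ (orient π))

  fork : (∃₂ λ i j → i < j × tail i ≡ tail j) →
         ∃ λ d → ∃₂ λ d′ d″ → d′ ≢ d″ × d ⇝ d′ × d ⇝ d″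
  fork (i , j , i<j , tails-equal) =
    tail i , head i , head j , heads-differ , arc i ,
    subst (_⇝ head j) (sym tails-equal) (arc j)
    where
    heads-differ : head i ≢ head j
    heads-differ heads-equal = <⇒≢ i<j (endpoints-injective i j (tail i) (head i)
      (proj₂ (proj₂ (orient i)))
      (subst₂ (Endpoints j) (sym tails-equal) (sym heads-equal) (proj₂ (proj₂ (orient j)))))

module LowerBound {G : Graph} (compass : Compass G) {k : ℕ} (c : EdgeColouring G k)
                  (star : IsStarEdgeColouring G c) where
  open Compass compass

  c-sym : Symmetric G c
  c-sym = proj₁ star

  proper : Proper G c
  proper = proj₁ (proj₂ star)

  colourAt : V G → Dir → Fin k
  colourAt v d = c v (nbr d v)

  colourAt-injective : ∀ v → Injective _≡_ _≡_ (colourAt v)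
  colourAt-injective v {d} {d′} e = decidable-stable (d ≟ d′) λ d≢d′ →
    proper v _ _ (adj-nbr d v) (adj-nbr d′ v) (d≢d′ ∘ nbr-injective v) e

  Misses : V G → Fin k → Set
  Misses w x = ∀ e → colourAt w e ≢ x

  two-missing⇒6≤k : ∀ {w x y} → Misses w x → Misses w y → x ≢ y → 6 ≤ k
  two-missing⇒6≤k {w} {x} {y} misses-x misses-y x≢y =
    injective⇒≤ (fresh-∷-injective (fresh-∷-injective (colourAt-injective w) misses-x)
                                    fresh-y)
    where
    fresh-y : ∀ i → (x ∷ colourAt w) i ≢ y
    fresh-y zero    = x≢y
    fresh-y (suc e) = misses-y e

  no-colour-exchange : ∀ v {d d′ e₁ e₂} → d ≢ d′ →
                       colourAt (nbr d v) e₁ ≡ colourAt v d′ →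
                       colourAt (nbr d′ v) e₂ ≡ colourAt v d → ⊥
  no-colour-exchange v {d} {d′} {e₁} {e₂} d≢d′ hit₁ hit₂ =
    star⇒noAlternatingWalk adj-sym adj-irreflexive star
      (adj-sym (adj-nbr e₁ x₁)) (adj-sym (adj-nbr d v)) (adj-nbr d′ v) (adj-nbr e₂ y₁)
      x₂≢v x₁≢y₁ v≢y₂
      (trans (c-sym _ _ (adj-sym (adj-nbr e₁ x₁))) hit₁)
      (trans (c-sym _ _ (adj-sym (adj-nbr d v))) (sym hit₂))
    where
    x₁ y₁ x₂ y₂ : V G
    x₁ = nbr d v
    y₁ = nbr d′ v
    x₂ = nbr e₁ x₁
    y₂ = nbr e₂ y₁

    x₂≢v : x₂ ≢ v
    x₂≢v x₂≡v = d≢d′ (colourAt-injective v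
      (trans (c-sym v x₁ (adj-nbr d v)) (trans (cong (c x₁) (sym x₂≡v)) hit₁)))

    x₁≢y₁ : x₁ ≢ y₁
    x₁≢y₁ = d≢d′ ∘ nbr-injective v

    v≢y₂ : v ≢ y₂
    v≢y₂ v≡y₂ = d≢d′ (colourAt-injective v (sym
      (trans (c-sym v y₁ (adj-nbr d′ v)) (trans (cong (c y₁) v≡y₂) hit₂))))

  one-end-misses : ∀ v {d d′} → d ≢ d′ →
                   Misses (nbr d v) (colourAt v d′) ⊎ Misses (nbr d′ v) (colourAt v d)
  one-end-misses v {d} {d′} d≢d′
    with any? (λ e → colourAt (nbr d v) e ≟ colourAt v d′)
       | any? (λ e → colourAt (nbr d′ v) e ≟ colourAt v d)
  ... | no ¬hit         | _               = inj₁ λ e hit → ¬hit (e , hit)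
  ... | yes _           | no ¬hit         = inj₂ λ e hit → ¬hit (e , hit)
  ... | yes (_ , hit₁)  | yes (_ , hit₂)  = ⊥-elim (no-colour-exchange v d≢d′ hit₁ hit₂)

  6≤k : V G → 6 ≤ k
  6≤k v = fork⇒6≤k (tournament₄-outdegree≥2 {_⇝_ = _⇝_} (one-end-misses v))
    where
    _⇝_ : Dir → Dir → Set
    d ⇝ d′ = Misses (nbr d v) (colourAt v d′)

    fork⇒6≤k : (∃ λ d → ∃₂ λ d′ d″ → d′ ≢ d″ × d ⇝ d′ × d ⇝ d″) → 6 ≤ k
    fork⇒6≤k (_ , _ , _ , d′≢d″ , misses′ , misses″) =
      two-missing⇒6≤k misses′ misses″ (d′≢d″ ∘ colourAt-injective v)

suc₃ pred₃ : Fin 3 → Fin 3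
suc₃ zero             = suc zero
suc₃ (suc zero)       = suc (suc zero)
suc₃ (suc (suc zero)) = zero
pred₃ zero             = suc (suc zero)
pred₃ (suc zero)       = zero
pred₃ (suc (suc zero)) = suc zero

pred₃-suc₃ : ∀ x → pred₃ (suc₃ x) ≡ x
pred₃-suc₃ zero             = refl
pred₃-suc₃ (suc zero)       = refl
pred₃-suc₃ (suc (suc zero)) = refl

mod3 : ℕ → Fin 3
mod3 zero    = zero
mod3 (suc n) = suc₃ (mod3 n)

suc₃³ : ∀ x → suc₃ (suc₃ (suc₃ x)) ≡ x
suc₃³ zero             = refl
suc₃³ (suc zero)       = refl
suc₃³ (suc (suc zero)) = refl

mod3-*3 : ∀ k → mod3 (k * 3) ≡ zero
mod3-*3 zero    = refl
mod3-*3 (suc k) = trans (suc₃³ (mod3 (k * 3))) (mod3-*3 k)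

mod3-3* : ∀ k → mod3 (3 * k) ≡ zero
mod3-3* k = trans (cong mod3 (*-comm 3 k)) (mod3-*3 k)

Torus : Set
Torus = Fin 3 × Fin 3

_≟ₜ_ : (p q : Torus) → Dec (p ≡ q)
_≟ₜ_ = ≡-dec _≟_ _≟_

all-torus? : {P : Torus → Set} → (∀ p → Dec (P p)) → Dec (∀ p → P p)
all-torus? P? = map′ (λ h p → h (proj₁ p) (proj₂ p)) (λ h x y → h (x , y))
                     (all? λ x → all? λ y → P? (x , y))

step : Dir → Torus → Torus
step east  (x , y) = suc₃ x , y
step west  (x , y) = pred₃ x , y
step north (x , y) = x , suc₃ y
step south (x , y) = x , pred₃ y

-- The edge from (x , y) to (x + 1 , y) gets colour x + y and the edge from (x , y) to
-- (x , y + 1) colour x − y, both mod 3, from two disjoint palettes.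
horizontal vertical : Torus → Fin 6
horizontal (x , y) = mod3 (toℕ x + toℕ y) ↑ˡ 3
vertical   (x , y) = 3 ↑ʳ mod3 (toℕ x + 2 * toℕ y)

dirColour : Torus → Dir → Fin 6
dirColour p east  = horizontal p
dirColour p west  = horizontal (step west p)
dirColour p north = vertical p
dirColour p south = vertical (step south p)

edgeColour : Torus → Torus → Fin 6
edgeColour p q with any? (λ d → step d p ≟ₜ q)
... | yes (d , _) = dirColour p d
... | no _        = zero

step-injective : ∀ p d d′ → step d p ≡ step d′ p → d ≡ d′
step-injective = from-yes
  (all-torus? λ p → all? λ d → all? λ d′ → step d p ≟ₜ step d′ p →-dec d ≟ d′)

step-irreflexive : ∀ p d → step d p ≢ p
step-irreflexive = from-yes (all-torus? λ p → all? λ d → ¬? (step d p ≟ₜ p))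

edgeColour-step : ∀ p d → edgeColour p (step d p) ≡ dirColour p d
edgeColour-step = from-yes
  (all-torus? λ p → all? λ d → edgeColour p (step d p) ≟ dirColour p d)

dirColour-opp : ∀ p d → dirColour p d ≡ dirColour (step d p) (opp d)
dirColour-opp = from-yes
  (all-torus? λ p → all? λ d → dirColour p d ≟ dirColour (step d p) (opp d))

dirColour-injective : ∀ p d d′ → dirColour p d ≡ dirColour p d′ → d ≡ d′
dirColour-injective = from-yes
  (all-torus? λ p → all? λ d → all? λ d′ → dirColour p d ≟ dirColour p d′ →-dec d ≟ d′)

torus-noAlternatingWalk :
  ∀ p d₀ d₁ d₂ d₃ → d₁ ≢ opp d₀ → d₂ ≢ opp d₁ → d₃ ≢ opp d₂ →
  dirColour p d₀ ≡ dirColour (step d₁ (step d₀ p)) d₂ →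
  dirColour (step d₀ p) d₁ ≡ dirColour (step d₂ (step d₁ (step d₀ p))) d₃ → ⊥
torus-noAlternatingWalk = from-yes
  (all-torus? λ p → all? λ d₀ → all? λ d₁ → all? λ d₂ → all? λ d₃ →
     ¬? (d₁ ≟ opp d₀) →-dec ¬? (d₂ ≟ opp d₁) →-dec ¬? (d₃ ≟ opp d₂) →-dec
     dirColour p d₀ ≟ dirColour (step d₁ (step d₀ p)) d₂ →-dec
     dirColour (step d₀ p) d₁ ≟ dirColour (step d₂ (step d₁ (step d₀ p))) d₃ →-dec
     no λ ())

module TorusCover {G : Graph} (compass : Compass G) (proj : V G → Torus)
                  (proj-nbr : ∀ d u → proj (Compass.nbr compass d u) ≡ step d (proj u)) where
  open Compass compass

  colouring : EdgeColouring G 6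
  colouring u w = edgeColour (proj u) (proj w)

  colouring-nbr : ∀ {u q} d → proj u ≡ q → colouring u (nbr d u) ≡ dirColour q d
  colouring-nbr {u} d refl =
    trans (cong (edgeColour (proj u)) (proj-nbr d u)) (edgeColour-step (proj u) d)

  proj-nbr² : ∀ d e u → proj (nbr e (nbr d u)) ≡ step e (step d (proj u))
  proj-nbr² d e u = trans (proj-nbr e (nbr d u)) (cong (step e) (proj-nbr d u))

  colouring-symmetric : Symmetric G colouring
  colouring-symmetric u _ uw with adj⇒nbr uw
  ... | d , refl = begin
    colouring u (nbr d u)                         ≡⟨ colouring-nbr d refl ⟩
    dirColour (proj u) d                          ≡⟨ dirColour-opp (proj u) d ⟩
    dirColour (step d (proj u)) (opp d)           ≡⟨ colouring-nbr (opp d) (proj-nbr d u) ⟨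
    colouring (nbr d u) (nbr (opp d) (nbr d u))   ≡⟨ cong (colouring (nbr d u)) (nbr-opp d u) ⟩
    colouring (nbr d u) u                         ∎

  colouring-proper : Proper G colouring
  colouring-proper u _ _ uv uw v≢w with adj⇒nbr uv | adj⇒nbr uw
  ... | d , refl | d′ , refl = λ e → v≢w (cong (λ x → nbr x u)
    (dirColour-injective (proj u) d d′
      (trans (sym (colouring-nbr d refl)) (trans e (colouring-nbr d′ refl)))))

  non-backtracking : ∀ {u} d e → u ≢ nbr e (nbr d u) → e ≢ opp d
  non-backtracking {u} d _ u≢ refl = u≢ (sym (nbr-opp d u))

  colouring-noAlternatingWalk : NoAlternatingWalk colouring
  colouring-noAlternatingWalk {x₀} {x₁} {x₂} {x₃} {x₄}
    a₀₁ a₁₂ a₂₃ a₃₄ x₀≢x₂ x₁≢x₃ x₂≢x₄ c₀₁≡c₂₃ c₁₂≡c₃₄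
    with d₀ , refl ← adj⇒nbr {x₀} {x₁} a₀₁
       | d₁ , refl ← adj⇒nbr {x₁} {x₂} a₁₂
       | d₂ , refl ← adj⇒nbr {x₂} {x₃} a₂₃
       | d₃ , refl ← adj⇒nbr {x₃} {x₄} a₃₄
    = torus-noAlternatingWalk (proj x₀) d₀ d₁ d₂ d₃
        (non-backtracking d₀ d₁ x₀≢x₂) (non-backtracking d₁ d₂ x₁≢x₃)
        (non-backtracking d₂ d₃ x₂≢x₄)
        (trans (sym (colouring-nbr d₀ refl))
          (trans c₀₁≡c₂₃ (colouring-nbr d₂ (proj-nbr² d₀ d₁ x₀))))
        (trans (sym (colouring-nbr d₁ (proj-nbr d₀ x₀)))
          (trans c₁₂≡c₃₄ (colouring-nbr d₃
            (trans (proj-nbr d₂ _) (cong (step d₂) (proj-nbr² d₀ d₁ x₀))))))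

  star-colourable : StarColourable G 6
  star-colourable = colouring , noAlternatingWalk⇒star adj-sym
    colouring-symmetric colouring-proper colouring-noAlternatingWalk

module CycleSteps {n : ℕ} where
  next prev : Fin (suc n) → Fin (suc n)
  next i with suc (toℕ i) <? suc n
  ... | yes i+1<1+n = fromℕ< i+1<1+n
  ... | no _        = zero
  prev zero    = fromℕ n
  prev (suc i) = inject₁ i

  CycSucc-next : ∀ i → CycSucc (suc n) i (next i)
  CycSucc-next i with suc (toℕ i) <? suc n
  ... | yes i+1<1+n = inj₁ (sym (toℕ-fromℕ< i+1<1+n))
  ... | no i+1≮1+n  = inj₂ (≤-antisym (toℕ<n i) (≮⇒≥ i+1≮1+n) , refl)

  CycSucc⇒next : ∀ {i j} → CycSucc (suc n) i j → j ≡ next i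
  CycSucc⇒next {i} {j} succ with suc (toℕ i) <? suc n | succ
  ... | yes i+1<1+n | inj₁ i+1≡j =
    toℕ-injective (trans (sym i+1≡j) (sym (toℕ-fromℕ< i+1<1+n)))
  ... | yes i+1<1+n | inj₂ (i+1≡1+n , _) =
    ⊥-elim (<-irrefl refl (subst (Data.Nat._< suc n) i+1≡1+n i+1<1+n))
  ... | no i+1≮1+n  | inj₁ i+1≡j =
    ⊥-elim (i+1≮1+n (subst (Data.Nat._< suc n) (sym i+1≡j) (toℕ<n j)))
  ... | no _        | inj₂ (_ , j≡0) = toℕ-injective j≡0

  CycSucc-prev : ∀ i → CycSucc (suc n) (prev i) i
  CycSucc-prev zero    = inj₂ (cong suc (toℕ-fromℕ n) , refl)
  CycSucc-prev (suc i) = inj₁ (cong suc (toℕ-inject₁ i))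

  CycSucc⇒prev : ∀ {i j} → CycSucc (suc n) j i → j ≡ prev i
  CycSucc⇒prev {zero}  (inj₂ (j+1≡1+n , _)) =
    toℕ-injective (trans (suc-injective j+1≡1+n) (sym (toℕ-fromℕ n)))
  CycSucc⇒prev {suc i} (inj₁ j+1≡i+1) =
    toℕ-injective (trans (suc-injective j+1≡i+1) (sym (toℕ-inject₁ i)))

  prev-next : ∀ i → prev (next i) ≡ i
  prev-next i = sym (CycSucc⇒prev (CycSucc-next i))

  next-prev : ∀ i → next (prev i) ≡ i
  next-prev i = sym (CycSucc⇒next (CycSucc-prev i))

  module _ (mod3[1+n]≡0 : mod3 (suc n) ≡ zero) where

    mod3-CycSucc : ∀ {i j} → CycSucc (suc n) i j → mod3 (toℕ j) ≡ suc₃ (mod3 (toℕ i))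
    mod3-CycSucc (inj₁ i+1≡j) = cong mod3 (sym i+1≡j)
    mod3-CycSucc (inj₂ (i+1≡1+n , j≡0)) =
      trans (cong mod3 j≡0) (trans (sym mod3[1+n]≡0) (cong mod3 (sym i+1≡1+n)))

    mod3-next : ∀ i → mod3 (toℕ (next i)) ≡ suc₃ (mod3 (toℕ i))
    mod3-next i = mod3-CycSucc (CycSucc-next i)

    mod3-prev : ∀ i → mod3 (toℕ (prev i)) ≡ pred₃ (mod3 (toℕ i))
    mod3-prev i = trans (sym (pred₃-suc₃ _)) (cong pred₃ (sym (mod3-CycSucc (CycSucc-prev i))))

module TorusGrid (k ℓ : ℕ) where
  open CycleSteps

  G : Graph
  G = Cycle (3 * suc k) □ Cycle (3 * suc ℓ)

  nbr : Dir → V G → V G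
  nbr east  (i , j) = next i , j
  nbr west  (i , j) = prev i , j
  nbr north (i , j) = i , next j
  nbr south (i , j) = i , prev j

  proj : V G → Torus
  proj (i , j) = mod3 (toℕ i) , mod3 (toℕ j)

  proj-nbr : ∀ d u → proj (nbr d u) ≡ step d (proj u)
  proj-nbr east  (i , j) = cong (_, mod3 (toℕ j)) (mod3-next (mod3-3* (suc k)) i)
  proj-nbr west  (i , j) = cong (_, mod3 (toℕ j)) (mod3-prev (mod3-3* (suc k)) i)
  proj-nbr north (i , j) = cong (mod3 (toℕ i) ,_) (mod3-next (mod3-3* (suc ℓ)) j)
  proj-nbr south (i , j) = cong (mod3 (toℕ i) ,_) (mod3-prev (mod3-3* (suc ℓ)) j)

  adj-nbr : ∀ d u → Adj G u (nbr d u)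
  adj-nbr east  (i , j) = inj₁ (inj₁ (CycSucc-next i) , refl)
  adj-nbr west  (i , j) = inj₁ (inj₂ (CycSucc-prev i) , refl)
  adj-nbr north (i , j) = inj₂ (refl , inj₁ (CycSucc-next j))
  adj-nbr south (i , j) = inj₂ (refl , inj₂ (CycSucc-prev j))

  adj⇒nbr : ∀ {u w} → Adj G u w → ∃ λ d → w ≡ nbr d u
  adj⇒nbr (inj₁ (inj₁ succ , refl)) = east  , cong (_, _) (CycSucc⇒next succ)
  adj⇒nbr (inj₁ (inj₂ succ , refl)) = west  , cong (_, _) (CycSucc⇒prev succ)
  adj⇒nbr (inj₂ (refl , inj₁ succ)) = north , cong (_ ,_) (CycSucc⇒next succ)
  adj⇒nbr (inj₂ (refl , inj₂ succ)) = south , cong (_ ,_) (CycSucc⇒prev succ)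

  nbr-opp : ∀ d u → nbr (opp d) (nbr d u) ≡ u
  nbr-opp east  (i , j) = cong (_, j) (prev-next i)
  nbr-opp west  (i , j) = cong (_, j) (next-prev i)
  nbr-opp north (i , j) = cong (i ,_) (prev-next j)
  nbr-opp south (i , j) = cong (i ,_) (next-prev j)

  compass : Compass G
  compass = record
    { nbr             = nbr
    ; adj-nbr         = adj-nbr
    ; adj⇒nbr         = adj⇒nbr
    ; nbr-opp         = nbr-opp
    ; nbr-injective   = λ u {d} {d′} e → step-injective (proj u) d d′
                          (trans (sym (proj-nbr d u)) (trans (cong proj e) (proj-nbr d′ u)))
    ; nbr-irreflexive = λ d u e → step-irreflexive (proj u) d
                          (trans (sym (proj-nbr d u)) (cong proj e))
    }

corollary12 : (k ℓ : ℕ) → 1 ≤ k → 1 ≤ ℓ →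
    StarChromaticIndexIs (Cycle (3 * k) □ Cycle (3 * ℓ)) 6
corollary12 (suc k) (suc ℓ) _ _ =
  TorusCover.star-colourable compass proj proj-nbr ,
  λ n (c , star) → LowerBound.6≤k compass c star (zero , zero)
  where
  open TorusGrid k ℓ
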